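{- Fix $E \subseteq \mathbb{Z}$ and $n \in \mathbb{N}$. Then $\mathcal{T}_n$ is a Boolean algebra of subsets of $\mathbb{Z}^n$ (it is closed under complement in $\mathbb{Z}^n$, finite intersections and finite unions).
   Context: A set is Presburger if it is first-order definable in $(\mathbb{Z},<,+)$. For $X \subseteq \mathbb{Z}^{m+n}$ and $u \in \mathbb{Z}^m$, the fiber is $X_u = \{x \in \mathbb{Z}^n : (u,x) \in X\}$; an intersection over an empty index set of subsets of $\mathbb{Z}^n$ is $\mathbb{Z}^n$. Given $E \subseteq \mathbb{Z}$, a set $A \subseteq \mathbb{Z}^n$ belongs to $\mathcal{T}_n$ iff there exist $m \in \mathbb{N}$, a Presburger set $X \subseteq \mathbb{Z}^{m+n}$, and an indexed family $(P_\alpha)_{\alpha \in I}$ of subsets of $E^m$ (with $I$ an arbitrary index set) such that $A = \bigcup_{\alpha \in I} \bigcap_{u \in P_\alpha} X_u$. -}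

module Defs where

open import Level using (Level)
open import Data.Nat using (ℕ; _+_)
open import Data.Fin using (Fin)
open import Data.Integer using (ℤ) renaming (_+_ to _+ℤ_; _<_ to _<ℤ_)
open import Data.Vec.Functional using (Vector; _++_; _∷_)
open import Data.Product using (Σ; Σ-syntax; _×_; ∃)
open import Data.Sum using (_⊎_)
open import Data.Unit using (⊤)
open import Data.Empty using (⊥)
open import Relation.Nullary using (¬_)
open import Relation.Binary.PropositionalEquality using (_≡_)
open import Function.Bundles using (_⇔_)

Subset : ℕ → Set₁
Subset k = Vector ℤ k → Set

data Term (k : ℕ) : Set where
  var  : Fin k → Term k
  _⊕_  : Term k → Term k → Term k

data Formula : ℕ → Set where
  _≐_  : ∀ {k} → Term k → Term k → Formula k
  _≺_  : ∀ {k} → Term k → Term k → Formula k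
  ¬'_  : ∀ {k} → Formula k → Formula k
  _∧'_ : ∀ {k} → Formula k → Formula k → Formula k
  _∨'_ : ∀ {k} → Formula k → Formula k → Formula k
  ∃'_  : ∀ {k} → Formula (Data.Nat.suc k) → Formula k
  ∀'_  : ∀ {k} → Formula (Data.Nat.suc k) → Formula k

evalT : ∀ {k} → Term k → Vector ℤ k → ℤ
evalT (var i) ρ = ρ i
evalT (s ⊕ t) ρ = evalT s ρ +ℤ evalT t ρ

-- Tarskian semantics; variable 0 is the most recently bound one.
⟦_⟧ : ∀ {k} → Formula k → Vector ℤ k → Set
⟦ s ≐ t ⟧ ρ = evalT s ρ ≡ evalT t ρ
⟦ s ≺ t ⟧ ρ = evalT s ρ <ℤ evalT t ρ
⟦ ¬' φ ⟧ ρ = ¬ ⟦ φ ⟧ ρ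
⟦ φ ∧' ψ ⟧ ρ = ⟦ φ ⟧ ρ × ⟦ ψ ⟧ ρ
⟦ φ ∨' ψ ⟧ ρ = ⟦ φ ⟧ ρ ⊎ ⟦ ψ ⟧ ρ
⟦ ∃' φ ⟧ ρ = Σ ℤ λ z → ⟦ φ ⟧ (z ∷ ρ)
⟦ ∀' φ ⟧ ρ = (z : ℤ) → ⟦ φ ⟧ (z ∷ ρ)

IsPresburger : ∀ {k} → Subset k → Set
IsPresburger {k} X = Σ (Formula k) λ φ → ∀ v → X v ⇔ ⟦ φ ⟧ v

Fiber : ∀ {m n} → Subset (m + n) → Vector ℤ m → Subset n
Fiber X u x = X (u ++ x)

-- A ∈ 𝒯_n (relative to E ⊆ ℤ): there are m, a Presburger X ⊆ ℤ^(m+n), and a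
-- family (P_α)_{α∈I} of subsets of E^m with A = ⋃_α ⋂_{u ∈ P_α} X_u.
-- (Empty intersection = ℤ^n automatically.)
𝒯 : (E : ℤ → Set) (n : ℕ) → Subset n → Set₂
𝒯 E n A =
  Σ[ m ∈ ℕ ] Σ[ X ∈ Subset (m + n) ] IsPresburger X ×
  (Σ[ I ∈ Set₁ ] Σ[ P ∈ (I → Vector ℤ m → Set) ]
     ((α : I) (u : Vector ℤ m) → P α u → (i : Fin m) → E (u i)) ×
     ((x : Vector ℤ n) → A x ⇔ (Σ[ α ∈ I ] ((u : Vector ℤ m) → P α u → Fiber X u x))))

Full : ∀ {n} → Subset n
Full _ = ⊤

Empty : ∀ {n} → Subset n
Empty _ = ⊥

Compl : ∀ {n} → Subset n → Subset n
Compl A x = ¬ A x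

_∩_ : ∀ {n} → Subset n → Subset n → Subset n
(A ∩ B) x = A x × B x

_∪_ : ∀ {n} → Subset n → Subset n → Subset n
(A ∪ B) x = A x ⊎ B x

{-# OPTIONS --safe #-}
-- Complement: a point x ∉ A is separated from A by the parameters u ∈ E^m with
-- x ∉ X_u: if y ∈ A via α, then x ∉ A forces (classically) x ∉ X_u for some
-- u ∈ P_α, while y ∈ X_u. Hence ∁A = ⋃_{x ∉ A} ⋂ {(∁X)_u : u ∈ E^m, x ∉ X_u}, and ∁X is Presburger.
-- Intersection: concatenate the parameters of the two representations, index by
-- pairs (α , β), and take the conjunction of the two formulas with their
-- variables rearranged. Union then follows by De Morgan.
module Submission where

open import Defs
open import Data.Nat using (ℕ; _+_)
open import Data.Integer using (ℤ) renaming (_+_ to _+ℤ_; _<_ to _<ℤ_)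
open import Data.Fin as Fin using (Fin; splitAt; _↑ˡ_; _↑ʳ_)
open import Data.Product using (_×_; Σ; ∃; ∃₂; _,_; proj₁; proj₂)
open import Data.Product.Function.NonDependent.Propositional using (_×-⇔_)
open import Data.Product.Function.Dependent.Propositional using (congˡ)
open import Data.Sum using (_⊎_; inj₁; inj₂; [_,_])
open import Data.Sum.Function.Propositional using (_⊎-⇔_)
open import Data.Sum.Properties using ([,]-∘; [,]-cong)
open import Data.Unit using (⊤; tt)
open import Data.Empty using (⊥; ⊥-elim)
open import Data.Vec.Functional using (Vector; _++_; _∷_)
open import Data.Vec.Functional.Properties using (lookup-++ˡ; lookup-++ʳ)
open import Data.Vec.Functional.Relation.Unary.All using (All)
open import Data.Vec.Functional.Relation.Unary.All.Properties using (++⁺)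
open import Level using (Lift; lift)
open import Function using (_∘_; id)
open import Function.Bundles using (_⇔_; mk⇔; Equivalence)
import Function.Properties.Equivalence as ⇔
open import Function.Related.TypeIsomorphisms using (¬-cong-⇔)
open import Relation.Nullary using (¬_; yes; no)
open import Relation.Binary.PropositionalEquality using (_≡_; _≗_; refl; sym; trans; cong₂; subst₂)
open import Axiom.ExcludedMiddle using (ExcludedMiddle)
open import Axiom.DoubleNegationElimination using (em⇒dne)

open Equivalence

private
  variable
    k l m₁ m₂ n : ℕ

renameTerm : (Fin k → Fin l) → Term k → Term l
renameTerm σ (var i) = var (σ i)
renameTerm σ (s ⊕ t) = renameTerm σ s ⊕ renameTerm σ t

rename : (Fin k → Fin l) → Formula k → Formula l
rename σ (s ≐ t) = renameTerm σ s ≐ renameTerm σ t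
rename σ (s ≺ t) = renameTerm σ s ≺ renameTerm σ t
rename σ (¬' φ) = ¬' rename σ φ
rename σ (φ ∧' ψ) = rename σ φ ∧' rename σ ψ
rename σ (φ ∨' ψ) = rename σ φ ∨' rename σ ψ
rename σ (∃' φ) = ∃' rename (Fin.lift 1 σ) φ
rename σ (∀' φ) = ∀' rename (Fin.lift 1 σ) φ

evalT-renameTerm : (σ : Fin k → Fin l) (t : Term k) {ρ : Vector ℤ l} {ρ′ : Vector ℤ k} →
                   ρ ∘ σ ≗ ρ′ → evalT (renameTerm σ t) ρ ≡ evalT t ρ′
evalT-renameTerm σ (var i) ρσ≗ρ′ = ρσ≗ρ′ i
evalT-renameTerm σ (s ⊕ t) ρσ≗ρ′ =
  cong₂ _+ℤ_ (evalT-renameTerm σ s ρσ≗ρ′) (evalT-renameTerm σ t ρσ≗ρ′)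

∷-lift : (σ : Fin k → Fin l) {ρ : Vector ℤ l} {ρ′ : Vector ℤ k} (z : ℤ) →
         ρ ∘ σ ≗ ρ′ → (z ∷ ρ) ∘ Fin.lift 1 σ ≗ z ∷ ρ′
∷-lift σ z ρσ≗ρ′ Fin.zero = refl
∷-lift σ z ρσ≗ρ′ (Fin.suc i) = ρσ≗ρ′ i

subst₂-⇔ : ∀ {A : Set} (R : A → A → Set) {a a′ b b′ : A} → a ≡ a′ → b ≡ b′ → R a b ⇔ R a′ b′
subst₂-⇔ R a≡a′ b≡b′ = mk⇔ (subst₂ R a≡a′ b≡b′) (subst₂ R (sym a≡a′) (sym b≡b′))

⟦rename⟧ : (σ : Fin k → Fin l) (φ : Formula k) {ρ : Vector ℤ l} {ρ′ : Vector ℤ k} →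
           ρ ∘ σ ≗ ρ′ → ⟦ rename σ φ ⟧ ρ ⇔ ⟦ φ ⟧ ρ′
⟦rename⟧ σ (s ≐ t) h = subst₂-⇔ _≡_ (evalT-renameTerm σ s h) (evalT-renameTerm σ t h)
⟦rename⟧ σ (s ≺ t) h = subst₂-⇔ _<ℤ_ (evalT-renameTerm σ s h) (evalT-renameTerm σ t h)
⟦rename⟧ σ (¬' φ) h = ¬-cong-⇔ (⟦rename⟧ σ φ h)
⟦rename⟧ σ (φ ∧' ψ) h = ⟦rename⟧ σ φ h ×-⇔ ⟦rename⟧ σ ψ h
⟦rename⟧ σ (φ ∨' ψ) h = ⟦rename⟧ σ φ h ⊎-⇔ ⟦rename⟧ σ ψ h
⟦rename⟧ σ (∃' φ) h = congˡ λ {z} → ⟦rename⟧ (Fin.lift 1 σ) φ (∷-lift σ z h)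
⟦rename⟧ σ (∀' φ) h = mk⇔ (λ f z → to (step z) (f z)) (λ f z → from (step z) (f z))
  where step = λ z → ⟦rename⟧ (Fin.lift 1 σ) φ (∷-lift σ z h)

⟦⟧-resp-≗ : (φ : Formula k) {ρ ρ′ : Vector ℤ k} → ρ ≗ ρ′ → ⟦ φ ⟧ ρ ⇔ ⟦ φ ⟧ ρ′
⟦⟧-resp-≗ φ ρ≗ρ′ = ⇔.trans (⇔.sym (⟦rename⟧ id φ λ _ → refl)) (⟦rename⟧ id φ ρ≗ρ′)

IsPresburger-resp-≗ : {X : Subset k} → IsPresburger X → {v w : Vector ℤ k} → v ≗ w → X v ⇔ X w
IsPresburger-resp-≗ (φ , X⇔φ) {v} {w} v≗w =
  ⇔.trans (X⇔φ v) (⇔.trans (⟦⟧-resp-≗ φ v≗w) (⇔.sym (X⇔φ w)))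

Full-isPresburger : IsPresburger (Full {k})
Full-isPresburger = ∀' (var Fin.zero ≐ var Fin.zero) , λ _ → mk⇔ (λ _ _ → refl) (λ _ → tt)

Compl-isPresburger : {X : Subset k} → IsPresburger X → IsPresburger (Compl X)
Compl-isPresburger (φ , X⇔φ) = ¬' φ , λ v → ¬-cong-⇔ (X⇔φ v)

∩-isPresburger : {X Y : Subset k} → IsPresburger X → IsPresburger Y → IsPresburger (X ∩ Y)
∩-isPresburger (φ , X⇔φ) (ψ , Y⇔ψ) = φ ∧' ψ , λ v → X⇔φ v ×-⇔ Y⇔ψ v

reindex-isPresburger : (σ : Fin k → Fin l) {X : Subset k} →
                       IsPresburger X → IsPresburger (λ w → X (w ∘ σ))
reindex-isPresburger σ (φ , X⇔φ) =
  rename σ φ , λ w → ⇔.trans (X⇔φ (w ∘ σ)) (⇔.sym (⟦rename⟧ σ φ λ _ → refl))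

skipMiddle : ∀ m₁ m₂ {n} → Fin (m₁ + n) → Fin ((m₁ + m₂) + n)
skipMiddle m₁ m₂ {n} = (λ j → (j ↑ˡ m₂) ↑ˡ n) ++ ((m₁ + m₂) ↑ʳ_)

skipFirst : ∀ m₁ m₂ {n} → Fin (m₂ + n) → Fin ((m₁ + m₂) + n)
skipFirst m₁ m₂ {n} = (λ j → (m₁ ↑ʳ j) ↑ˡ n) ++ ((m₁ + m₂) ↑ʳ_)

++-skipMiddle : ∀ {A : Set} (u : Vector A m₁) (v : Vector A m₂) (x : Vector A n) →
                ((u ++ v) ++ x) ∘ skipMiddle m₁ m₂ ≗ u ++ x
++-skipMiddle {m₁ = m₁} u v x i =
  trans ([,]-∘ ((u ++ v) ++ x) (splitAt m₁ i))
        ([,]-cong (λ j → trans (lookup-++ˡ (u ++ v) x _) (lookup-++ˡ u v j))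
                  (lookup-++ʳ (u ++ v) x)
                  (splitAt m₁ i))

++-skipFirst : ∀ {A : Set} (u : Vector A m₁) (v : Vector A m₂) (x : Vector A n) →
               ((u ++ v) ++ x) ∘ skipFirst m₁ m₂ ≗ v ++ x
++-skipFirst {m₂ = m₂} u v x i =
  trans ([,]-∘ ((u ++ v) ++ x) (splitAt m₂ i))
        ([,]-cong (λ j → trans (lookup-++ˡ (u ++ v) x _) (lookup-++ʳ u v j))
                  (lookup-++ʳ (u ++ v) x)
                  (splitAt m₂ i))

module _ (E : ℤ → Set) where

  𝒯-resp-⇔ : {A B : Subset n} → (∀ x → A x ⇔ B x) → 𝒯 E n A → 𝒯 E n B
  𝒯-resp-⇔ A⇔B (m , X , X-pres , I , P , P⊆E , A⇔) =
    m , X , X-pres , I , P , P⊆E , λ x → ⇔.trans (⇔.sym (A⇔B x)) (A⇔ x)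

  𝒯-Full : 𝒯 E n Full
  𝒯-Full = 0 , Full , Full-isPresburger , Lift _ ⊤ , (λ _ _ → ⊥) , (λ _ _ ()) ,
           λ _ → mk⇔ (λ _ → lift tt , λ _ ()) (λ _ → tt)

  𝒯-Empty : 𝒯 E n Empty
  𝒯-Empty = 0 , Full , Full-isPresburger , Lift _ ⊥ , (λ _ _ → ⊥) , (λ _ _ ()) ,
            λ _ → mk⇔ (λ ()) (λ { (lift () , _) })

  Inhabited : {A : Subset n} → 𝒯 E n A → Set₁
  Inhabited (_ , _ , _ , I , P , _) = (α : I) → ∃ (P α)

  -- The product construction needs every P_α inhabited: the empty intersection
  -- over P_α × P_β would otherwise also erase the other factor.
  𝒯-∩-inhabited : {A B : Subset n} (a : 𝒯 E n A) (b : 𝒯 E n B) →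
                  Inhabited a → Inhabited b → 𝒯 E n (A ∩ B)
  𝒯-∩-inhabited {n = n} {A} {B}
    (m₁ , X₁ , X₁-pres , I₁ , P₁ , P₁⊆E , A⇔) (m₂ , X₂ , X₂-pres , I₂ , P₂ , P₂⊆E , B⇔)
    inhabited₁ inhabited₂ =
    m₁ + m₂ , X , X-pres , (I₁ × I₂) , P , P⊆E , λ x → mk⇔ (∈-⋃⋂ x) (∈-∩ x)
    where
    X : Subset ((m₁ + m₂) + n)
    X = (λ w → X₁ (w ∘ skipMiddle m₁ m₂)) ∩ (λ w → X₂ (w ∘ skipFirst m₁ m₂))

    X-pres : IsPresburger X
    X-pres = ∩-isPresburger (reindex-isPresburger (skipMiddle m₁ m₂) X₁-pres)
                            (reindex-isPresburger (skipFirst m₁ m₂) X₂-pres)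

    P : I₁ × I₂ → Vector ℤ (m₁ + m₂) → Set
    P (α , β) u = ∃₂ λ u₁ u₂ → P₁ α u₁ × P₂ β u₂ × u ≡ u₁ ++ u₂

    P⊆E : ∀ γ u → P γ u → All E u
    P⊆E (α , β) _ (u₁ , u₂ , p₁ , p₂ , refl) = ++⁺ E (P₁⊆E α u₁ p₁) (P₂⊆E β u₂ p₂)

    X-fiber : ∀ u₁ u₂ x → X ((u₁ ++ u₂) ++ x) ⇔ (X₁ (u₁ ++ x) × X₂ (u₂ ++ x))
    X-fiber u₁ u₂ x = IsPresburger-resp-≗ X₁-pres (++-skipMiddle u₁ u₂ x)
                  ×-⇔ IsPresburger-resp-≗ X₂-pres (++-skipFirst u₁ u₂ x)

    ∈-⋃⋂ : ∀ x → (A ∩ B) x → Σ (I₁ × I₂) λ γ → ∀ u → P γ u → Fiber X u x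
    ∈-⋃⋂ x (x∈A , x∈B) with to (A⇔ x) x∈A | to (B⇔ x) x∈B
    ... | α , x∈⋂₁ | β , x∈⋂₂ = (α , β) , λ where
      _ (u₁ , u₂ , p₁ , p₂ , refl) → from (X-fiber u₁ u₂ x) (x∈⋂₁ u₁ p₁ , x∈⋂₂ u₂ p₂)

    ∈-∩ : ∀ x → (Σ (I₁ × I₂) λ γ → ∀ u → P γ u → Fiber X u x) → (A ∩ B) x
    ∈-∩ x ((α , β) , x∈⋂) = from (A⇔ x) (α , ∈X₁) , from (B⇔ x) (β , ∈X₂)
      where
      ∈X₁ : ∀ u₁ → P₁ α u₁ → X₁ (u₁ ++ x)
      ∈X₁ u₁ p₁ with inhabited₂ β
      ... | u₂ , p₂ = proj₁ (to (X-fiber u₁ u₂ x) (x∈⋂ _ (u₁ , u₂ , p₁ , p₂ , refl)))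
      ∈X₂ : ∀ u₂ → P₂ β u₂ → X₂ (u₂ ++ x)
      ∈X₂ u₂ p₂ with inhabited₁ α
      ... | u₁ , p₁ = proj₂ (to (X-fiber u₁ u₂ x) (x∈⋂ _ (u₁ , u₂ , p₁ , p₂ , refl)))

  module _ (em : ∀ {ℓ} → ExcludedMiddle ℓ) where

    private
      dne : ∀ {ℓ} {P : Set ℓ} → ¬ ¬ P → P
      dne = em⇒dne em

    full-or-inhabited : {A : Subset n} (a : 𝒯 E n A) → (∀ x → A x) ⊎ Inhabited a
    full-or-inhabited (_ , _ , _ , I , P , _ , A⇔) with em {P = ∃ λ α → ¬ ∃ (P α)}
    ... | yes (α , P-empty) = inj₁ λ x → from (A⇔ x) (α , λ u p → ⊥-elim (P-empty (u , p)))
    ... | no ¬some-empty = inj₂ λ α → dne λ P-empty → ¬some-empty (α , P-empty)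

    𝒯-∩ : {A B : Subset n} → 𝒯 E n A → 𝒯 E n B → 𝒯 E n (A ∩ B)
    𝒯-∩ a b with full-or-inhabited a | full-or-inhabited b
    ... | inj₁ A-full | _ = 𝒯-resp-⇔ (λ x → mk⇔ (λ x∈B → A-full x , x∈B) proj₂) b
    ... | inj₂ _ | inj₁ B-full = 𝒯-resp-⇔ (λ x → mk⇔ (λ x∈A → x∈A , B-full x) proj₁) a
    ... | inj₂ a-inhabited | inj₂ b-inhabited = 𝒯-∩-inhabited a b a-inhabited b-inhabited

    𝒯-Compl : {A : Subset n} → 𝒯 E n A → 𝒯 E n (Compl A)
    𝒯-Compl {n = n} {A} (m , X , X-pres , I , P , P⊆E , A⇔) =
      m , Compl X , Compl-isPresburger X-pres , Lift _ (Σ (Vector ℤ n) (Compl A)) , P′ ,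
      (λ _ _ → proj₁) , λ y → mk⇔ (λ y∉A → lift (y , y∉A) , λ _ → proj₂) (separated y)
      where
      P′ : Lift _ (Σ (Vector ℤ n) (Compl A)) → Vector ℤ m → Set
      P′ (lift (x , _)) u = All E u × ¬ X (u ++ x)

      separated : ∀ y → (Σ _ λ ξ → ∀ u → P′ ξ u → ¬ X (u ++ y)) → ¬ A y
      separated y (lift (x , x∉A) , y∉X) y∈A with to (A⇔ y) y∈A
      ... | α , y∈⋂ = x∉A (from (A⇔ x) (α , λ u p → dne λ x∉Xᵤ →
                        y∉X u (P⊆E α u p , x∉Xᵤ) (y∈⋂ u p)))

    𝒯-∪ : {A B : Subset n} → 𝒯 E n A → 𝒯 E n B → 𝒯 E n (A ∪ B)
    𝒯-∪ {A = A} {B} a b = 𝒯-resp-⇔ deMorgan (𝒯-Compl (𝒯-∩ (𝒯-Compl a) (𝒯-Compl b)))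
      where
      deMorgan : ∀ x → Compl (Compl A ∩ Compl B) x ⇔ (A ∪ B) x
      deMorgan x = mk⇔ (λ ¬both → dne λ ¬either → ¬both (¬either ∘ inj₁ , ¬either ∘ inj₂))
                       (λ either (x∉A , x∉B) → [ x∉A , x∉B ] either)

mainTheorem6 : (∀ {ℓ} → ExcludedMiddle ℓ) → (E : ℤ → Set) (n : ℕ) →
    ((A : Subset n) → 𝒯 E n A → 𝒯 E n (Compl A)) ×
    𝒯 E n Full × 𝒯 E n Empty ×
    ((A B : Subset n) → 𝒯 E n A → 𝒯 E n B → 𝒯 E n (A ∩ B)) ×
    ((A B : Subset n) → 𝒯 E n A → 𝒯 E n B → 𝒯 E n (A ∪ B))
mainTheorem6 em E n =
  (λ _ → 𝒯-Compl E em) , 𝒯-Full E , 𝒯-Empty E ,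
  (λ _ _ → 𝒯-∩ E em) , (λ _ _ → 𝒯-∪ E em)
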